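{- There is a deterministic finite automaton with $17$ states, reading triples over the alphabet $\{ -1,0,1\}\times\{0,1\}\times\{0,1\}$, such that for every finite sequence $\mathbf f\in\{ -1,1\}^*$ with $|\mathbf f|\ge1$ and all integers $n,x\ge 0$, it accepts the parallel input consisting of $\mathbf f$ (padded with trailing $0$'s), $n$ and $x$ (written in base $2$, least-significant digit first, padded with trailing $0$'s; all three of a common length) if and only if $0\le n\le 2^{|\mathbf f|-1}$ and $x=S_{\mathbf f}[n]$. Likewise there is a deterministic finite automaton with $13$ states with the same property for $E_{\mathbf f}[n]$ in place of $S_{\mathbf f}[n]$. That is, a single synchronized automaton computes $S_{\mathbf f}$ (resp. $E_{\mathbf f}$) for all paperfolding sequences simultaneously.
   Context: For a finite sequence $\mathbf f$ over $\{ -1,1\}$ define $P_\epsilon=\epsilon$ (empty) and $P_{\mathbf f a}=P_{\mathbf f}\ a\ (-P_{\mathbf f}^R)$ for $a\in\{ -1,1\}$, where $-x$ negates every entry and $x^R$ is reversal; $|P_{\mathbf f}|=2^{|\mathbf f|}-1$. Index $P_{\mathbf f}=p_1p_2\cdots$ from $1$. A run is a maximal block of consecutive identical entries; runs are numbered left to right from $1$, and $S_{\mathbf f}[n]$, $E_{\mathbf f}[n]$ denote the starting and ending positions of the $n$-th run ($P_{\mathbf f}$ has $2^{|\mathbf f|-1}$ runs). By convention $S_{\mathbf f}[0]=E_{\mathbf f}[0]=0$. The unfolding instructions are fed to the automaton as a word over $\{ -1,0,1\}$ consisting of $\mathbf f$ followed by $0$'s; $0$'s are allowed only at the end and are ignored.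 -}

module Defs where

open import Data.Nat using (ℕ; zero; suc; _+_; _∸_; _^_; _≤_; _<_; _%_; _/_; _≡ᵇ_)
open import Data.Bool using (Bool; true; false; if_then_else_)
open import Data.Fin using (Fin)
open import Data.List using (List; []; _∷_; _++_; map; reverse; foldl; length; replicate; zipWith)
open import Data.Maybe using (Maybe; just; nothing; _>>=_)
open import Data.Product using (Σ; _×_; _,_)
open import Data.Sign using (Sign; opposite) renaming (+ to s+; - to s-)
open import Relation.Binary.PropositionalEquality using (_≡_)

pfStep : List Sign → Sign → List Sign
pfStep P a = P ++ (a ∷ map opposite (reverse P))

P : List Sign → List Sign
P f = foldl pfStep [] f

sameSign : Sign → Sign → Bool
sameSign s+ s+ = true
sameSign s- s- = true
sameSign _  _  = false

-- starting positions (1-indexed) of the runs, left to right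
startsFrom : ℕ → Maybe Sign → List Sign → List ℕ
startsFrom i prev [] = []
startsFrom i nothing (a ∷ as) = i ∷ startsFrom (suc i) (just a) as
startsFrom i (just b) (a ∷ as) =
  if sameSign a b then startsFrom (suc i) (just a) as
                  else i ∷ startsFrom (suc i) (just a) as

-- ending positions (1-indexed) of the runs, left to right
endsFrom : ℕ → List Sign → List ℕ
endsFrom i [] = []
endsFrom i (a ∷ []) = i ∷ []
endsFrom i (a ∷ b ∷ as) =
  if sameSign a b then endsFrom (suc i) (b ∷ as)
                  else i ∷ endsFrom (suc i) (b ∷ as)

-- k-th element (0-indexed), default 0 when out of range
nth : List ℕ → ℕ → ℕ
nth [] _ = 0
nth (x ∷ xs) zero = x
nth (x ∷ xs) (suc k) = nth xs k

-- S_f[n], E_f[n]; S_f[0] = E_f[0] = 0.  (Values for n beyond the number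
-- of runs are irrelevant: the theorem only uses them when n ≤ 2^{|f|-1}.)
S : List Sign → ℕ → ℕ
S f zero = 0
S f (suc m) = nth (startsFrom 1 nothing (P f)) m

E : List Sign → ℕ → ℕ
E f zero = 0
E f (suc m) = nth (endsFrom 1 (P f)) m

data Tri : Set where
  neg zer pos : Tri

Letter : Set
Letter = Tri × Bool × Bool

signToTri : Sign → Tri
signToTri s- = neg
signToTri s+ = pos

-- f followed by 0's, total length L (assumes |f| ≤ L)
fWord : ℕ → List Sign → List Tri
fWord L f = map signToTri f ++ replicate (L ∸ length f) zer

-- base-2 digits of n, least significant first, exactly L digits
-- (true = 1); a faithful representation padded with trailing 0's when n < 2^L
bits : ℕ → ℕ → List Bool
bits zero n = []
bits (suc L) n = (n % 2 ≡ᵇ 1) ∷ bits L (n / 2)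

zip3 : {A B C : Set} → List A → List B → List C → List (A × B × C)
zip3 (a ∷ as) (b ∷ bs) (c ∷ cs) = (a , b , c) ∷ zip3 as bs cs
zip3 _ _ _ = []

input : ℕ → List Sign → ℕ → ℕ → List Letter
input L f n x = zip3 (fWord L f) (bits L n) (bits L x)

-- Deterministic finite automata with k states (states = Fin k).
-- Following the Walnut convention, the transition function may be
-- partial (a missing transition means rejection).

record DFA (k : ℕ) : Set where
  field
    start  : Fin k
    δ      : Fin k → Letter → Maybe (Fin k)
    accept : Fin k → Bool

runFrom : {k : ℕ} → DFA k → Maybe (Fin k) → List Letter → Maybe (Fin k)
runFrom M q [] = q
runFrom M q (c ∷ w) = runFrom M (q >>= λ s → DFA.δ M s c) w

Accepts : {k : ℕ} → DFA k → List Letter → Set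
Accepts M w = Σ (Fin _) λ q → (runFrom M (just (DFA.start M)) w ≡ just q) × (DFA.accept M q ≡ true)

Computes : {k : ℕ} → DFA k → (List Sign → ℕ → ℕ) → Set
Computes M g =
  ∀ (f : List Sign) → 1 ≤ length f →
  ∀ (L n x : ℕ) → length f ≤ L → n < 2 ^ L → x < 2 ^ L →
  (Accepts M (input L f n x) → (n ≤ 2 ^ (length f ∸ 1)) × (x ≡ g f n)) ×
  ((n ≤ 2 ^ (length f ∸ 1)) × (x ≡ g f n) → Accepts M (input L f n x))

-- Unfolding with first instruction a turns P g into P (a ∷ g) = a q₁ (-a) q₂ a q₃ ⋯, the
-- symbols q of P g interleaved with an alternating sequence.  Hence every run of P (a ∷ g) has
-- length 1 or 2: its (j+2)-nd run starts at 2j+2 or 2j+3 according as the (j+1)-st symbol of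
-- P g differs from or equals (-1)ʲ a (ends of runs are analogous).  Iterating, the m-th symbol
-- of P g for m = 2ᵏ(2y+1) is (-1)ʸ gₖ.  So after the first letter (a, n₀, x₀) the claim
-- x = S (a ∷ g) n becomes a condition on the remaining instructions g and halves n′, x′:
-- x′ = 2n′ + k (or x′ + 1 = 2n′), possibly with "the x′-th symbol of P g is c".  Such conditions
-- reproduce themselves under one more letter: an even x′ drops the first instruction, while
-- x′ = 2y + 1 fixes the symbol as (-1)ʸ g₀, whose sign is read off the parity of n′.  The states
-- of the automaton are these conditions.

module Submission where

open import Defs
open import Data.Bool using (Bool; true; false; not; if_then_else_)
open import Data.Bool.Properties using (not-¬)
open import Data.Empty using (⊥; ⊥-elim)
open import Data.List using (List; []; _∷_; _++_; _∷ʳ_; map; reverse; foldl; length)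
open import Data.List.Properties using (unfold-reverse; ++-assoc; length-reverse)
open import Data.Fin using (Fin; #_)
open import Data.Maybe as Maybe using (Maybe; just; nothing)
open import Data.Nat using (ℕ; zero; suc; _+_; _*_; _^_; _≤_; _<_; _%_; _/_; _≡ᵇ_; z≤n; s≤s)
open import Data.Nat.DivMod using (m/n≡1+[m∸n]/n; m<n*o⇒m/o<n)
open import Data.Nat.Properties
open import Data.Product using (Σ; _×_; _,_; proj₁; proj₂; map₂)
open import Data.Sum using (_⊎_; inj₁; inj₂)
open import Data.Sum.Function.Propositional using (_⊎-⇔_)
open import Data.Vec using (Vec; []; _∷_; lookup)
open import Data.Sign using (Sign; opposite) renaming (+ to s+; - to s-)
open import Data.Sign.Properties using (opposite-involutive)
open import Function using (id; case_of_)
open import Function.Bundles using (_⇔_; mk⇔; module Equivalence)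
open import Function.Properties.Equivalence using () renaming (trans to ⇔-trans; sym to ⇔-sym)
open import Relation.Nullary using (¬_)
open import Relation.Binary.PropositionalEquality

open Equivalence using (to; from)

consBit : Bool → ℕ → ℕ
consBit false y = y + y
consBit true  y = suc (y + y)

unconsBit : ℕ → Bool × ℕ
unconsBit zero          = false , zero
unconsBit (suc zero)    = true , zero
unconsBit (suc (suc n)) = map₂ suc (unconsBit n)

double-suc : ∀ y → suc y + suc y ≡ suc (suc (y + y))
double-suc y = cong suc (+-suc y y)

unconsBit-consBit : ∀ b y → unconsBit (consBit b y) ≡ (b , y)
unconsBit-consBit false zero    = refl
unconsBit-consBit true  zero    = refl
unconsBit-consBit false (suc y) rewrite double-suc y | unconsBit-consBit false y = refl
unconsBit-consBit true  (suc y) rewrite +-suc y y    | unconsBit-consBit true y  = refl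

consBit-injective : ∀ b c y w → consBit b y ≡ consBit c w → b ≡ c × y ≡ w
consBit-injective b c y w eq
  with trans (sym (unconsBit-consBit b y)) (trans (cong unconsBit eq) (unconsBit-consBit c w))
... | refl = refl , refl

consBit-true≢false : ∀ y w → consBit true y ≢ consBit false w
consBit-true≢false y w eq with consBit-injective true false y w eq
... | () , _

consBit-split : ∀ n → n ≡ consBit (n % 2 ≡ᵇ 1) (n / 2)
consBit-split zero          = refl
consBit-split (suc zero)    = refl
consBit-split (suc (suc n)) rewrite m/n≡1+[m∸n]/n {suc (suc n)} {2} (s≤s (s≤s z≤n))
  with n % 2 ≡ᵇ 1 | consBit-split n
... | false | eq = trans (cong (λ k → 2 + k) eq) (sym (double-suc (n / 2)))
... | true  | eq = trans (cong (λ k → 2 + k) eq) (cong suc (sym (double-suc (n / 2))))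

consBit-≥ : ∀ b y → y + y ≤ consBit b y
consBit-≥ false y = ≤-refl
consBit-≥ true  y = n≤1+n _

consBit-< : ∀ b y → consBit b y < suc y + suc y
consBit-< false y = ≤-trans (n≤1+n _) (≤-reflexive (sym (double-suc y)))
consBit-< true  y = ≤-reflexive (sym (double-suc y))

consBit<double⇔ : ∀ b y m → consBit b y < m + m ⇔ y < m
consBit<double⇔ b y m = mk⇔
  (λ lt → ≰⇒> (λ m≤y → <⇒≱ lt (≤-trans (+-mono-≤ m≤y m≤y) (consBit-≥ b y))))
  (λ lt → <-≤-trans (consBit-< b y) (+-mono-≤ lt lt))

-- The first unfolding instruction

alternate : Sign → ℕ → Sign
alternate a zero    = a
alternate a (suc j) = alternate (opposite a) j

alternate-opposite : ∀ a k → alternate (opposite a) k ≡ opposite (alternate a k)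
alternate-opposite a zero    = refl
alternate-opposite a (suc k) = alternate-opposite (opposite a) k

alternate-alternate : ∀ a k → alternate (alternate a k) k ≡ a
alternate-alternate a zero    = refl
alternate-alternate a (suc k) = begin
  alternate (opposite (alternate (opposite a) k)) k ≡⟨ alternate-opposite _ k ⟩
  opposite (alternate (alternate (opposite a) k) k) ≡⟨ cong opposite (alternate-alternate (opposite a) k) ⟩
  opposite (opposite a)                             ≡⟨ opposite-involutive a ⟩
  a                                                 ∎
  where open ≡-Reasoning

alternate-double : ∀ a y → alternate a (y + y) ≡ a
alternate-double a zero    = refl
alternate-double a (suc y) rewrite +-suc y y | opposite-involutive a = alternate-double a y

flipIf : Bool → Sign → Sign
flipIf false a = a
flipIf true  a = opposite a

alternate-consBit : ∀ a b y → alternate a (consBit b y) ≡ flipIf b a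
alternate-consBit a false y = alternate-double a y
alternate-consBit a true  y = trans (alternate-opposite a (y + y)) (cong opposite (alternate-double a y))

interleaveTail : Sign → List Sign → List Sign
interleaveTail a []       = []
interleaveTail a (q ∷ qs) = q ∷ opposite a ∷ interleaveTail (opposite a) qs

interleave : Sign → List Sign → List Sign
interleave a qs = a ∷ interleaveTail a qs

interleave-++ : ∀ a ys x zs →
  interleave a (ys ++ x ∷ zs) ≡ interleave a ys ++ x ∷ interleave (opposite (alternate a (length ys))) zs
interleave-++ a []       x zs = refl
interleave-++ a (y ∷ ys) x zs = cong (λ l → a ∷ y ∷ l) (interleave-++ (opposite a) ys x zs)

reverse-interleave : ∀ a xs → reverse (interleave a xs) ≡ interleave (alternate a (length xs)) (reverse xs)
reverse-interleave a []       = refl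
reverse-interleave a (x ∷ xs) = begin
  reverse (a ∷ x ∷ ys)                     ≡⟨ unfold-reverse a (x ∷ ys) ⟩
  reverse (x ∷ ys) ∷ʳ a                    ≡⟨ cong (_∷ʳ a) (unfold-reverse x ys) ⟩
  (reverse ys ∷ʳ x) ∷ʳ a                   ≡⟨ ++-assoc (reverse ys) (x ∷ []) (a ∷ []) ⟩
  reverse ys ++ x ∷ a ∷ []                 ≡⟨ cong (_++ x ∷ a ∷ []) (reverse-interleave (opposite a) xs) ⟩
  interleave c (reverse xs) ++ x ∷ a ∷ []  ≡⟨ cong (λ s → interleave c (reverse xs) ++ x ∷ s ∷ []) (sym last≡a) ⟩
  interleave c (reverse xs) ++ x ∷ interleave (opposite (alternate c (length (reverse xs)))) []
                                           ≡⟨ sym (interleave-++ c (reverse xs) x []) ⟩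
  interleave c (reverse xs ∷ʳ x)           ≡⟨ cong (interleave c) (sym (unfold-reverse x xs)) ⟩
  interleave c (reverse (x ∷ xs))          ∎
  where
  open ≡-Reasoning
  ys = interleave (opposite a) xs
  c  = alternate (opposite a) (length xs)
  last≡a : opposite (alternate c (length (reverse xs))) ≡ a
  last≡a rewrite length-reverse xs | alternate-alternate (opposite a) (length xs) = opposite-involutive a

map-opposite-interleave : ∀ a ys → map opposite (interleave a ys) ≡ interleave (opposite a) (map opposite ys)
map-opposite-interleave a []       = refl
map-opposite-interleave a (y ∷ ys) =
  cong (λ l → opposite a ∷ opposite y ∷ l) (map-opposite-interleave (opposite a) ys)

pfStep-interleave : ∀ a xs b → pfStep (interleave a xs) b ≡ interleave a (pfStep xs b)
pfStep-interleave a xs b = begin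
  interleave a xs ++ b ∷ map opposite (reverse (interleave a xs))
    ≡⟨ cong (λ l → interleave a xs ++ b ∷ map opposite l) (reverse-interleave a xs) ⟩
  interleave a xs ++ b ∷ map opposite (interleave (alternate a (length xs)) (reverse xs))
    ≡⟨ cong (λ l → interleave a xs ++ b ∷ l) (map-opposite-interleave _ (reverse xs)) ⟩
  interleave a xs ++ b ∷ interleave (opposite (alternate a (length xs))) (map opposite (reverse xs))
    ≡⟨ sym (interleave-++ a xs b _) ⟩
  interleave a (pfStep xs b) ∎
  where open ≡-Reasoning

foldl-pfStep-interleave : ∀ a xs g → foldl pfStep (interleave a xs) g ≡ interleave a (foldl pfStep xs g)
foldl-pfStep-interleave a xs []      = refl
foldl-pfStep-interleave a xs (b ∷ g) rewrite pfStep-interleave a xs b = foldl-pfStep-interleave a (pfStep xs b) g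

P-∷ : ∀ a g → P (a ∷ g) ≡ interleave a (P g)
P-∷ a g = foldl-pfStep-interleave a [] g

2^∣_∣ : List Sign → ℕ
2^∣ g ∣ = 2 ^ length g

2^∣∷∣ : ∀ a g → 2^∣ a ∷ g ∣ ≡ 2^∣ g ∣ + 2^∣ g ∣
2^∣∷∣ a g = cong (2^∣ g ∣ +_) (+-identityʳ 2^∣ g ∣)

length-interleaveTail : ∀ a xs → length (interleaveTail a xs) ≡ length xs + length xs
length-interleaveTail a []       = refl
length-interleaveTail a (x ∷ xs) rewrite length-interleaveTail (opposite a) xs = sym (cong suc (+-suc _ _))

suc-length-P : ∀ g → suc (length (P g)) ≡ 2^∣ g ∣
suc-length-P []      = refl
suc-length-P (a ∷ g) rewrite P-∷ a g | length-interleaveTail a (P g) | 2^∣∷∣ a g | sym (suc-length-P g) =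
  cong suc (sym (+-suc _ _))

-- Symbols of P g by position

entry : List Sign → ℕ → Sign
entry []       _       = s+
entry (x ∷ xs) zero    = x
entry (x ∷ xs) (suc i) = entry xs i

symbolAt : List Sign → ℕ → Sign
symbolAt []      m = s+
symbolAt (b ∷ h) m with unconsBit m
... | true  , y = alternate b y
... | false , y = symbolAt h y

symbolAt-∷-odd : ∀ b h y → symbolAt (b ∷ h) (consBit true y) ≡ alternate b y
symbolAt-∷-odd b h y rewrite unconsBit-consBit true y = refl

symbolAt-∷-even : ∀ b h y → symbolAt (b ∷ h) (consBit false y) ≡ symbolAt h y
symbolAt-∷-even b h y rewrite unconsBit-consBit false y = refl

entry-interleave-even : ∀ a qs j → j ≤ length qs →
                        entry (interleave a qs) (consBit false j) ≡ alternate a j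
entry-interleave-even a qs       zero    _         = refl
entry-interleave-even a (q ∷ qs) (suc j) (s≤s j≤) rewrite +-suc j j = entry-interleave-even (opposite a) qs j j≤

entry-interleave-odd : ∀ a qs j → j < length qs →
                       entry (interleave a qs) (consBit true j) ≡ entry qs j
entry-interleave-odd a (q ∷ qs) zero    _         = refl
entry-interleave-odd a (q ∷ qs) (suc j) (s≤s j<) rewrite +-suc j j = entry-interleave-odd (opposite a) qs j j<

<2^∣∷∣⇔ : ∀ a g b y → consBit b y < 2^∣ a ∷ g ∣ ⇔ y < 2^∣ g ∣
<2^∣∷∣⇔ a g b y =
  subst (λ m → (consBit b y < m) ⇔ (y < 2^∣ g ∣)) (sym (2^∣∷∣ a g)) (consBit<double⇔ b y 2^∣ g ∣)

<2^⇒<length-P : ∀ g {j} → suc j < 2^∣ g ∣ → j < length (P g)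
<2^⇒<length-P g lt = ≤-pred (subst (_ <_) (sym (suc-length-P g)) lt)

entry-P : ∀ g i → suc i < 2^∣ g ∣ → entry (P g) i ≡ symbolAt g (suc i)
entry-P []      i (s≤s ())
entry-P (a ∷ h) i lt with i % 2 ≡ᵇ 1 | i / 2 | consBit-split i
... | b | j | refl rewrite P-∷ a h = byParity b j lt
  where
  open ≡-Reasoning
  byParity : ∀ b j → suc (consBit b j) < 2^∣ a ∷ h ∣ →
             entry (interleave a (P h)) (consBit b j) ≡ symbolAt (a ∷ h) (suc (consBit b j))
  byParity false j lt = begin
    entry (interleave a (P h)) (consBit false j) ≡⟨ entry-interleave-even a (P h) j j≤ ⟩
    alternate a j                                ≡⟨ sym (symbolAt-∷-odd a h j) ⟩
    symbolAt (a ∷ h) (consBit true j)            ∎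
    where
    j≤ : j ≤ length (P h)
    j≤ = ≤-pred (subst (j <_) (sym (suc-length-P h)) (to (<2^∣∷∣⇔ a h true j) lt))
  byParity true j lt = begin
    entry (interleave a (P h)) (consBit true j) ≡⟨ entry-interleave-odd a (P h) j (<2^⇒<length-P h sj<) ⟩
    entry (P h) j                               ≡⟨ entry-P h j sj< ⟩
    symbolAt h (suc j)                          ≡⟨ sym (symbolAt-∷-even a h (suc j)) ⟩
    symbolAt (a ∷ h) (suc j + suc j)            ≡⟨ cong (symbolAt (a ∷ h)) (double-suc j) ⟩
    symbolAt (a ∷ h) (suc (consBit true j))     ∎
    where
    sj< : suc j < 2^∣ h ∣
    sj< = to (<2^∣∷∣⇔ a h false (suc j)) (subst (_< 2^∣ a ∷ h ∣) (sym (double-suc j)) lt)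

-- Runs of P (a ∷ g)

startsFrom-interleaveTail : ∀ i a q qs →
  startsFrom (consBit false i) (just a) (interleaveTail a (q ∷ qs)) ≡
  consBit (sameSign q a) i ∷ startsFrom (2 + consBit false i) (just (opposite a)) (interleaveTail (opposite a) qs)
startsFrom-interleaveTail i s+ s+ qs = refl
startsFrom-interleaveTail i s+ s- qs = refl
startsFrom-interleaveTail i s- s+ qs = refl
startsFrom-interleaveTail i s- s- qs = refl

endsFrom-interleave : ∀ k a q qs →
  endsFrom k (interleave a (q ∷ qs)) ≡
  (if sameSign q a then suc k else k) ∷ endsFrom (2 + k) (interleave (opposite a) qs)
endsFrom-interleave k s+ s+ qs = refl
endsFrom-interleave k s+ s- qs = refl
endsFrom-interleave k s- s+ qs = refl
endsFrom-interleave k s- s- qs = refl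

nth-startsFrom-interleaveTail : ∀ i a qs j → j < length qs →
  nth (startsFrom (consBit false i) (just a) (interleaveTail a qs)) j ≡
  consBit (sameSign (entry qs j) (alternate a j)) (i + j)
nth-startsFrom-interleaveTail i a (q ∷ qs) zero _
  rewrite startsFrom-interleaveTail i a q qs | +-identityʳ i = refl
nth-startsFrom-interleaveTail i a (q ∷ qs) (suc j) (s≤s j<)
  rewrite startsFrom-interleaveTail i a q qs | +-suc i j | sym (double-suc i) =
  nth-startsFrom-interleaveTail (suc i) (opposite a) qs j j<

nth-endsFrom-interleave : ∀ i a qs j → j < length qs →
  nth (endsFrom (consBit true i) (interleave a qs)) j ≡
  (if sameSign (entry qs j) (alternate a j) then suc (consBit true (i + j)) else consBit true (i + j))
nth-endsFrom-interleave i a (q ∷ qs) zero _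
  rewrite endsFrom-interleave (consBit true i) a q qs | +-identityʳ i = refl
nth-endsFrom-interleave i a (q ∷ qs) (suc j) (s≤s j<)
  rewrite endsFrom-interleave (consBit true i) a q qs | +-suc i j | sym (double-suc i) =
  nth-endsFrom-interleave (suc i) (opposite a) qs j j<

nth-endsFrom-interleave-last : ∀ i a qs →
  nth (endsFrom (consBit true i) (interleave a qs)) (length qs) ≡ consBit true (i + length qs)
nth-endsFrom-interleave-last i a []       rewrite +-identityʳ i = refl
nth-endsFrom-interleave-last i a (q ∷ qs)
  rewrite endsFrom-interleave (consBit true i) a q qs | +-suc i (length qs) | sym (double-suc i) =
  nth-endsFrom-interleave-last (suc i) (opposite a) qs

S-∷-1 : ∀ a g → S (a ∷ g) 1 ≡ 1
S-∷-1 a g rewrite P-∷ a g = refl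

S-∷-2+ : ∀ a g j → suc j < 2^∣ g ∣ →
  S (a ∷ g) (2 + j) ≡ consBit (sameSign (symbolAt g (suc j)) (alternate a j)) (suc j)
S-∷-2+ a g j lt rewrite P-∷ a g | sym (entry-P g j lt) =
  nth-startsFrom-interleaveTail 1 a (P g) j (<2^⇒<length-P g lt)

E-∷-suc : ∀ a g j → suc j < 2^∣ g ∣ →
  E (a ∷ g) (suc j) ≡
  (if sameSign (symbolAt g (suc j)) (alternate a j) then suc (consBit true j) else consBit true j)
E-∷-suc a g j lt rewrite P-∷ a g | sym (entry-P g j lt) =
  nth-endsFrom-interleave 0 a (P g) j (<2^⇒<length-P g lt)

E-∷-last : ∀ a g j → suc j ≡ 2^∣ g ∣ → E (a ∷ g) (suc j) ≡ consBit true j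
E-∷-last a g j eq with suc-injective (trans (suc-length-P g) (sym eq))
... | refl rewrite P-∷ a g = nth-endsFrom-interleave-last 0 a (P g)

-- The automata

data Target : Set where
  starts ends : Target

runFunction : Target → List Sign → ℕ → ℕ
runFunction starts = S
runFunction ends   = E

data State : Target → Set where
  start zeros                             : ∀ {t} → State t
  doubled                                 : ∀ {t} → Bool → State t
  markedOdd zerosOrMarkedEven             : ∀ {t} → Sign → State t
  doubledPred                             : State starts
  markedEven markedPred zerosOrMarkedPred : Sign → State starts
  markedSucc                              : Sign → Bool → State ends

guard : {A : Set} → Bool → Maybe A → Maybe A
guard true  r = r
guard false r = nothing

onSign : {A : Set} → Tri → Maybe A → (Sign → Maybe A) → Maybe A
onSign zer r k = r
onSign neg r k = k s-
onSign pos r k = k s+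

ifSignIs : {A : Set} → Tri → Bool → Sign → Maybe A → Maybe A
ifSignIs d n₀ c r = onSign d nothing (λ a → guard (sameSign (flipIf n₀ a) c) r)

startStep : ∀ t → Sign → Bool → Bool → Maybe (State t)
startStep starts a false false = just (zerosOrMarkedPred (opposite a))
startStep starts a false true  = just (markedPred a)
startStep starts a true  true  = just (zerosOrMarkedEven (opposite a))
startStep starts a true  false = just (markedEven a)
startStep ends   a true  true  = just (markedSucc (opposite a) true)
startStep ends   a true  false = just (markedOdd a)
startStep ends   a false false = just (zerosOrMarkedEven (opposite a))
startStep ends   a false true  = just (markedSucc a false)

markedPredStep : Tri → Bool → Bool → Sign → Maybe (State starts)
markedPredStep d n₀    false c = nothing
markedPredStep d true  true  c = ifSignIs d false c (just (doubled false))
markedPredStep d false true  c = ifSignIs d true c (just doubledPred)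

step : ∀ {t} → State t → Letter → Maybe (State t)
step {t} start (d , n₀ , x₀) = onSign d nothing (λ a → startStep t a n₀ x₀)
step zeros (d , false , false) = just zeros
step zeros (d , true  , x₀)    = nothing
step zeros (d , false , true)  = nothing
step (doubled false) (d , n₀ , false) = just (doubled n₀)
step (doubled false) (d , n₀ , true)  = nothing
step (doubled true)  (d , n₀ , true)  = onSign d nothing λ _ → just (doubled n₀)
step (doubled true)  (d , n₀ , false) = nothing
step doubledPred (d , n₀    , false) = nothing
step doubledPred (d , true  , true)  = onSign d nothing λ _ → just (doubled false)
step doubledPred (d , false , true)  = onSign d nothing λ _ → just doubledPred
step (markedOdd c) (d , n₀ , true)  = ifSignIs d n₀ c (just (doubled n₀))
step (markedOdd c) (d , n₀ , false) = nothing
step (markedEven c) (d , n₀    , true)  = nothing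
step (markedEven c) (d , false , false) = onSign d nothing λ _ → just (markedEven c)
step (markedEven c) (d , true  , false) = onSign d nothing λ _ → just (markedOdd c)
step (zerosOrMarkedEven c) (d , n₀    , true)  = nothing
step (zerosOrMarkedEven c) (d , true  , false) = onSign d nothing λ _ → just (markedOdd c)
step (zerosOrMarkedEven c) (d , false , false) = onSign d (just zeros) λ _ → just (zerosOrMarkedEven c)
step (markedPred c) (d , n₀ , x₀) = markedPredStep d n₀ x₀ c
step (zerosOrMarkedPred c) (d , n₀    , true)  = markedPredStep d n₀ true c
step (zerosOrMarkedPred c) (d , false , false) = just zeros
step (zerosOrMarkedPred c) (d , true  , false) = nothing
step (markedSucc c false) (d , n₀ , true)  = onSign d nothing λ _ → just (markedSucc c n₀)
step (markedSucc c false) (d , n₀ , false) = nothing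
step (markedSucc c true) (d , n₀ , false) =
  onSign d (guard (not n₀) (just zeros)) λ a → guard (sameSign (flipIf n₀ a) c) (just (doubled n₀))
step (markedSucc c true) (d , n₀ , true)  = nothing

accepting : ∀ {t} → State t → Bool
accepting start                 = false
accepting zeros                 = true
accepting (doubled k)           = not k
accepting (markedOdd c)         = false
accepting (zerosOrMarkedEven c) = true
accepting doubledPred           = false
accepting (markedEven c)        = false
accepting (markedPred c)        = false
accepting (zerosOrMarkedPred c) = true
accepting (markedSucc c k)      = k

-- `Invariant s f n x` is the condition under which s accepts the unread input, where f
-- is the unread part of the instructions and n, x are the numbers spelled by the unread bits.

Zero : ℕ → ℕ → Set
Zero n x = n ≡ 0 × x ≡ 0

Doubled : Bool → List Sign → ℕ → ℕ → Set
Doubled k f n x = x ≡ consBit k n × x < 2^∣ f ∣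

DoubledPred : List Sign → ℕ → ℕ → Set
DoubledPred f n x = suc x ≡ consBit false n × x < 2^∣ f ∣

Marked : Sign → Bool → List Sign → ℕ → ℕ → Set
Marked c k f n x = x ≡ consBit k n × 1 ≤ x × x < 2^∣ f ∣ × symbolAt f x ≡ c

MarkedPred : Sign → List Sign → ℕ → ℕ → Set
MarkedPred c f n x = suc x ≡ consBit false n × x < 2^∣ f ∣ × symbolAt f x ≡ c

MarkedOrEnd : Sign → List Sign → ℕ → Set
MarkedOrEnd c f y = y ≡ 2^∣ f ∣ ⊎ (y < 2^∣ f ∣ × symbolAt f y ≡ c)

MarkedSucc : Sign → Bool → List Sign → ℕ → ℕ → Set
MarkedSucc c k f n x = suc x ≡ consBit k n × MarkedOrEnd c f (suc x)

Computed : (List Sign → ℕ → ℕ) → List Sign → ℕ → ℕ → Set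
Computed g []      n x = ⊥
Computed g (a ∷ h) n x = n ≤ 2^∣ h ∣ × x ≡ g (a ∷ h) n

Invariant : ∀ {t} → State t → List Sign → ℕ → ℕ → Set
Invariant {t} start             f n x = Computed (runFunction t) f n x
Invariant zeros                 f n x = Zero n x
Invariant (doubled k)           f n x = Doubled k f n x
Invariant (markedOdd c)         f n x = Marked c true f n x
Invariant (zerosOrMarkedEven c) f n x = Zero n x ⊎ Marked c false f n x
Invariant doubledPred           f n x = DoubledPred f n x
Invariant (markedEven c)        f n x = Marked c false f n x
Invariant (markedPred c)        f n x = MarkedPred c f n x
Invariant (zerosOrMarkedPred c) f n x = Zero n x ⊎ MarkedPred c f n x
Invariant (markedSucc c k)      f n x = MarkedSucc c k f n x

HoldsAt : ∀ {t} → Maybe (State t) → List Sign → ℕ → ℕ → Set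
HoldsAt nothing  f n x = ⊥
HoldsAt (just s) f n x = Invariant s f n x

headLetter : List Sign → Tri
headLetter []      = zer
headLetter (a ∷ _) = signToTri a

tailSigns : List Sign → List Sign
tailSigns []      = []
tailSigns (_ ∷ g) = g

StepCorrect : ∀ {t} → State t → Set
StepCorrect s = ∀ f n₀ n x₀ x →
  Invariant s f (consBit n₀ n) (consBit x₀ x) ⇔ HoldsAt (step s (headLetter f , n₀ , x₀)) (tailSigns f) n x

onSign-signToTri : {A : Set} (a : Sign) (r : Maybe A) (k : Sign → Maybe A) →
                   onSign (signToTri a) r k ≡ k a
onSign-signToTri s+ r k = refl
onSign-signToTri s- r k = refl

sameSign≡⇔ : ∀ u c b → sameSign u c ≡ b ⇔ u ≡ flipIf (not b) c
sameSign≡⇔ s+ s+ true  = mk⇔ (λ _ → refl) (λ _ → refl)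
sameSign≡⇔ s+ s- true  = mk⇔ (λ ()) (λ ())
sameSign≡⇔ s- s+ true  = mk⇔ (λ ()) (λ ())
sameSign≡⇔ s- s- true  = mk⇔ (λ _ → refl) (λ _ → refl)
sameSign≡⇔ s+ s+ false = mk⇔ (λ ()) (λ ())
sameSign≡⇔ s+ s- false = mk⇔ (λ _ → refl) (λ _ → refl)
sameSign≡⇔ s- s+ false = mk⇔ (λ _ → refl) (λ _ → refl)
sameSign≡⇔ s- s- false = mk⇔ (λ ()) (λ ())

guard-sameSign⇔ : ∀ {t} u c (r : Maybe (State t)) {f n x} →
  HoldsAt (guard (sameSign u c) r) f n x ⇔ (u ≡ c × HoldsAt r f n x)
guard-sameSign⇔ u c r with sameSign u c in eq
... | true  = mk⇔ (to (sameSign≡⇔ u c true) eq ,_) proj₂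
... | false = mk⇔ ⊥-elim λ { (refl , _) → not-¬ (from (sameSign≡⇔ u u true) refl) eq }

ifSignIs-signToTri⇔ : ∀ {t} a n₀ c (r : Maybe (State t)) {f n x} →
  HoldsAt (ifSignIs (signToTri a) n₀ c r) f n x ⇔ (flipIf n₀ a ≡ c × HoldsAt r f n x)
ifSignIs-signToTri⇔ s+ n₀ c r = guard-sameSign⇔ (flipIf n₀ s+) c r
ifSignIs-signToTri⇔ s- n₀ c r = guard-sameSign⇔ (flipIf n₀ s-) c r

consBit-false<2^⇔ : ∀ f y → consBit false y < 2^∣ f ∣ ⇔ y < 2^∣ tailSigns f ∣
consBit-false<2^⇔ []      zero    = mk⇔ id id
consBit-false<2^⇔ []      (suc y) = mk⇔ (λ { (s≤s ()) }) (λ { (s≤s ()) })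
consBit-false<2^⇔ (a ∷ g) y       = <2^∣∷∣⇔ a g false y

consBit-true≮1 : ∀ y → ¬ consBit true y < 2^∣ [] ∣
consBit-true≮1 y (s≤s ())

suc-consBit≡consBit-false : ∀ x₀ x y → suc (consBit x₀ x) ≡ consBit false y → x₀ ≡ true × suc x ≡ y
suc-consBit≡consBit-false false x y eq = ⊥-elim (consBit-true≢false x y eq)
suc-consBit≡consBit-false true  x y eq =
  refl , proj₂ (consBit-injective false false (suc x) y (trans (double-suc x) eq))

suc-consBit-true : ∀ x y → suc x ≡ y → suc (consBit true x) ≡ consBit false y
suc-consBit-true x .(suc x) refl = sym (double-suc x)

Zero-consBit-false⇔ : ∀ n x → Zero (consBit false n) (consBit false x) ⇔ Zero n x
Zero-consBit-false⇔ n x =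
  mk⇔ (λ (p , q) → m+n≡0⇒m≡0 n p , m+n≡0⇒m≡0 x q) λ { (refl , refl) → refl , refl }

symbolAt-∷-odd-consBit : ∀ a g n₀ n → symbolAt (a ∷ g) (consBit true (consBit n₀ n)) ≡ flipIf n₀ a
symbolAt-∷-odd-consBit a g n₀ n = trans (symbolAt-∷-odd a g (consBit n₀ n)) (alternate-consBit a n₀ n)

Marked-[] : ∀ c k n x → ¬ Marked c k [] n x
Marked-[] c k n x (_ , 1≤x , x<1 , _) = <⇒≱ x<1 1≤x

Marked-even-∷⇔ : ∀ c a g n₀ n x →
  Marked c false (a ∷ g) (consBit n₀ n) (consBit false x) ⇔ Marked c n₀ g n x
Marked-even-∷⇔ c a g n₀ n x = mk⇔
  (λ (e , p , l , q) → proj₂ (consBit-injective false false x (consBit n₀ n) e) , 1≤double⇒ x p ,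
                        to (<2^∣∷∣⇔ a g false x) l ,
                        trans (sym (symbolAt-∷-even a g x)) q)
  (λ (e , p , l , q) → cong (consBit false) e , ≤-trans p (m≤m+n x x) , from (<2^∣∷∣⇔ a g false x) l ,
                        trans (symbolAt-∷-even a g x) q)
  where
  1≤double⇒ : ∀ y → 1 ≤ y + y → 1 ≤ y
  1≤double⇒ (suc y) _ = s≤s z≤n

Marked-odd-∷⇔ : ∀ c a g n₀ n x →
  Marked c true (a ∷ g) (consBit n₀ n) (consBit true x) ⇔ (flipIf n₀ a ≡ c × Doubled n₀ g n x)
Marked-odd-∷⇔ c a g n₀ n x = mk⇔ fwd bwd
  where
  sign = symbolAt-∷-odd-consBit a g n₀ n
  fwd : Marked c true (a ∷ g) (consBit n₀ n) (consBit true x) → flipIf n₀ a ≡ c × Doubled n₀ g n x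
  fwd (e , _ , l , q) with consBit-injective true true x (consBit n₀ n) e
  ... | _ , refl = trans (sym sign) q , refl , to (<2^∣∷∣⇔ a g true x) l
  bwd : flipIf n₀ a ≡ c × Doubled n₀ g n x → Marked c true (a ∷ g) (consBit n₀ n) (consBit true x)
  bwd (q , refl , l) = refl , s≤s z≤n , from (<2^∣∷∣⇔ a g true x) l , trans sign q

zeros-correct : ∀ {t} → StepCorrect (zeros {t})
zeros-correct f false n false x = Zero-consBit-false⇔ n x
zeros-correct f true  n x₀    x = mk⇔ (λ { (() , _) }) λ ()
zeros-correct f false n true  x = mk⇔ (λ { (_ , ()) }) λ ()

doubled-correct : ∀ {t} k → StepCorrect (doubled {t} k)
doubled-correct false f n₀ n false x = mk⇔
  (λ (e , l) → proj₂ (consBit-injective false false x (consBit n₀ n) e) , to (consBit-false<2^⇔ f x) l)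
  (λ (e , l) → cong (consBit false) e , from (consBit-false<2^⇔ f x) l)
doubled-correct false f n₀ n true x = mk⇔ (λ (e , _) → consBit-true≢false x (consBit n₀ n) e) λ ()
doubled-correct true f n₀ n false x = mk⇔ (λ (e , _) → consBit-true≢false (consBit n₀ n) x (sym e)) λ ()
doubled-correct true [] n₀ n true x = mk⇔ (λ (_ , l) → consBit-true≮1 x l) λ ()
doubled-correct {t} true (a ∷ g) n₀ n true x
  rewrite onSign-signToTri a nothing (λ _ → just (doubled {t} n₀)) = mk⇔
  (λ (e , l) → proj₂ (consBit-injective true true x (consBit n₀ n) e) , to (<2^∣∷∣⇔ a g true x) l)
  (λ (e , l) → cong (consBit true) e , from (<2^∣∷∣⇔ a g true x) l)

doubledPred-correct : StepCorrect doubledPred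
doubledPred-correct f n₀ n false x = mk⇔ (λ (e , _) → consBit-true≢false x (consBit n₀ n) e) λ ()
doubledPred-correct [] true  n true x = mk⇔ (λ (_ , l) → consBit-true≮1 x l) λ ()
doubledPred-correct [] false n true x = mk⇔ (λ (_ , l) → consBit-true≮1 x l) λ ()
doubledPred-correct (a ∷ g) true n true x
  rewrite onSign-signToTri a nothing (λ _ → just (doubled {starts} false)) = mk⇔
  (λ (e , l) → suc-injective (proj₂ (suc-consBit≡consBit-false true x (consBit true n) e)) ,
               to (<2^∣∷∣⇔ a g true x) l)
  (λ (e , l) → suc-consBit-true x (consBit true n) (cong suc e) , from (<2^∣∷∣⇔ a g true x) l)
doubledPred-correct (a ∷ g) false n true x
  rewrite onSign-signToTri a nothing (λ _ → just doubledPred) = mk⇔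
  (λ (e , l) → proj₂ (suc-consBit≡consBit-false true x (consBit false n) e) , to (<2^∣∷∣⇔ a g true x) l)
  (λ (e , l) → suc-consBit-true x (consBit false n) e , from (<2^∣∷∣⇔ a g true x) l)

markedEven-correct : ∀ c → StepCorrect (markedEven c)
markedEven-correct c f n₀ n true x = mk⇔ (λ (e , _) → consBit-true≢false x (consBit n₀ n) e) λ ()
markedEven-correct c [] false n false x = mk⇔ (Marked-[] c false (consBit false n) (consBit false x)) λ ()
markedEven-correct c [] true  n false x = mk⇔ (Marked-[] c false (consBit true n) (consBit false x)) λ ()
markedEven-correct c (a ∷ g) false n false x rewrite onSign-signToTri a nothing (λ _ → just (markedEven c)) =
  Marked-even-∷⇔ c a g false n x
markedEven-correct c (a ∷ g) true n false x rewrite onSign-signToTri a nothing (λ _ → just (markedOdd {starts} c)) =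
  Marked-even-∷⇔ c a g true n x

markedOdd-correct : ∀ {t} c → StepCorrect (markedOdd {t} c)
markedOdd-correct c f n₀ n false x = mk⇔ (λ (e , _) → consBit-true≢false (consBit n₀ n) x (sym e)) λ ()
markedOdd-correct c [] n₀ n true x = mk⇔ (Marked-[] c true (consBit n₀ n) (consBit true x)) λ ()
markedOdd-correct c (a ∷ g) n₀ n true x =
  ⇔-trans (Marked-odd-∷⇔ c a g n₀ n x) (⇔-sym (ifSignIs-signToTri⇔ a n₀ c (just (doubled n₀))))

zerosOrMarkedEven-correct : ∀ {t} c → StepCorrect (zerosOrMarkedEven {t} c)
zerosOrMarkedEven-correct c f n₀ n true x =
  mk⇔ (λ { (inj₁ (_ , ())) ; (inj₂ (e , _)) → consBit-true≢false x (consBit n₀ n) e }) λ ()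
zerosOrMarkedEven-correct c [] true n false x =
  mk⇔ (λ { (inj₁ (() , _)) ; (inj₂ m) → Marked-[] c false (consBit true n) (consBit false x) m }) λ ()
zerosOrMarkedEven-correct {t} c (a ∷ g) true n false x
  rewrite onSign-signToTri a nothing (λ _ → just (markedOdd {t} c)) =
  ⇔-trans (mk⇔ (λ { (inj₁ (() , _)) ; (inj₂ m) → m }) inj₂) (Marked-even-∷⇔ c a g true n x)
zerosOrMarkedEven-correct c [] false n false x =
  ⇔-trans (mk⇔ (λ { (inj₁ z) → z ; (inj₂ m) → ⊥-elim (Marked-[] c false (consBit false n) (consBit false x) m) }) inj₁)
          (Zero-consBit-false⇔ n x)
zerosOrMarkedEven-correct {t} c (a ∷ g) false n false x
  rewrite onSign-signToTri a (just (zeros {t})) (λ _ → just (zerosOrMarkedEven {t} c)) =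
  Zero-consBit-false⇔ n x ⊎-⇔ Marked-even-∷⇔ c a g false n x

alternate-pred : ∀ a n₀ n x → suc x ≡ consBit n₀ n → alternate a x ≡ flipIf (not n₀) a
alternate-pred a true  n       x eq rewrite suc-injective eq = alternate-double a n
alternate-pred a false (suc p) x eq rewrite +-suc p p with eq
... | refl = alternate-consBit a true p

MarkedPred-∷⇔ : ∀ c a g n₀ n x →
  MarkedPred c (a ∷ g) (consBit n₀ n) (consBit true x) ⇔
  (flipIf (not n₀) a ≡ c × suc x ≡ consBit n₀ n × x < 2^∣ g ∣)
MarkedPred-∷⇔ c a g n₀ n x = mk⇔
  (λ (e , l , q) → let e′ = proj₂ (suc-consBit≡consBit-false true x (consBit n₀ n) e) in
     trans (sym (sign e′)) q , e′ , to (<2^∣∷∣⇔ a g true x) l)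
  (λ (q , e′ , l) → suc-consBit-true x (consBit n₀ n) e′ , from (<2^∣∷∣⇔ a g true x) l ,
                    trans (sign e′) q)
  where
  sign : suc x ≡ consBit n₀ n → symbolAt (a ∷ g) (consBit true x) ≡ flipIf (not n₀) a
  sign e′ = trans (symbolAt-∷-odd a g x) (alternate-pred a n₀ n x e′)

markedPred-correct : ∀ c → StepCorrect (markedPred c)
markedPred-correct c f n₀ n false x = mk⇔ (λ (e , _) → consBit-true≢false x (consBit n₀ n) e) λ ()
markedPred-correct c [] true  n true x = mk⇔ (λ (_ , l , _) → consBit-true≮1 x l) λ ()
markedPred-correct c [] false n true x = mk⇔ (λ (_ , l , _) → consBit-true≮1 x l) λ ()
markedPred-correct c (a ∷ g) true n true x = ⇔-trans (MarkedPred-∷⇔ c a g true n x) (⇔-trans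
  (mk⇔ (λ (q , e , l) → q , suc-injective e , l) (λ (q , e , l) → q , cong suc e , l))
  (⇔-sym (ifSignIs-signToTri⇔ a false c (just (doubled false)))))
markedPred-correct c (a ∷ g) false n true x =
  ⇔-trans (MarkedPred-∷⇔ c a g false n x) (⇔-sym (ifSignIs-signToTri⇔ a true c (just doubledPred)))

zerosOrMarkedPred-correct : ∀ c → StepCorrect (zerosOrMarkedPred c)
zerosOrMarkedPred-correct c f n₀ n true x = mk⇔
  (λ { (inj₁ (_ , ())) ; (inj₂ m) → to (markedPred-correct c f n₀ n true x) m })
  (λ m → inj₂ (from (markedPred-correct c f n₀ n true x) m))
zerosOrMarkedPred-correct c f false n false x = ⇔-trans
  (mk⇔ (λ { (inj₁ z) → z ; (inj₂ (e , _)) → ⊥-elim (consBit-true≢false x (consBit false n) e) }) inj₁)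
  (Zero-consBit-false⇔ n x)
zerosOrMarkedPred-correct c f true n false x =
  mk⇔ (λ { (inj₁ (() , _)) ; (inj₂ (e , _)) → consBit-true≢false x (consBit true n) e }) λ ()

MarkedSucc-even-∷⇔ : ∀ c a g n₀ n x →
  MarkedSucc c false (a ∷ g) (consBit n₀ n) (consBit true x) ⇔ MarkedSucc c n₀ g n x
MarkedSucc-even-∷⇔ c a g n₀ n x = mk⇔
  (λ (e , d) → proj₂ (suc-consBit≡consBit-false true x (consBit n₀ n) e) , Data.Sum.map last fwd d)
  (λ (e , d) → suc-consBit-true x (consBit n₀ n) e , Data.Sum.map last′ bwd d)
  where
  open ≡-Reasoning
  y≡ : suc (consBit true x) ≡ consBit false (suc x)
  y≡ = sym (double-suc x)
  last : suc (consBit true x) ≡ 2^∣ a ∷ g ∣ → suc x ≡ 2^∣ g ∣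
  last eq = proj₂ (consBit-injective false false (suc x) 2^∣ g ∣ (trans (sym y≡) (trans eq (2^∣∷∣ a g))))
  last′ : suc x ≡ 2^∣ g ∣ → suc (consBit true x) ≡ 2^∣ a ∷ g ∣
  last′ eq = trans y≡ (trans (cong (consBit false) eq) (sym (2^∣∷∣ a g)))
  fwd : suc (consBit true x) < 2^∣ a ∷ g ∣ × symbolAt (a ∷ g) (suc (consBit true x)) ≡ c →
        suc x < 2^∣ g ∣ × symbolAt g (suc x) ≡ c
  fwd (l , q) = to (<2^∣∷∣⇔ a g false (suc x)) (subst (_< 2^∣ a ∷ g ∣) y≡ l) ,
                trans (sym (symbolAt-∷-even a g (suc x))) (trans (cong (symbolAt (a ∷ g)) (sym y≡)) q)
  bwd : suc x < 2^∣ g ∣ × symbolAt g (suc x) ≡ c →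
        suc (consBit true x) < 2^∣ a ∷ g ∣ × symbolAt (a ∷ g) (suc (consBit true x)) ≡ c
  bwd (l , q) = subst (_< 2^∣ a ∷ g ∣) (sym y≡) (from (<2^∣∷∣⇔ a g false (suc x)) l) ,
                trans (cong (symbolAt (a ∷ g)) y≡) (trans (symbolAt-∷-even a g (suc x)) q)

MarkedSucc-odd-∷⇔ : ∀ c a g n₀ n x →
  MarkedSucc c true (a ∷ g) (consBit n₀ n) (consBit false x) ⇔ (flipIf n₀ a ≡ c × Doubled n₀ g n x)
MarkedSucc-odd-∷⇔ c a g n₀ n x = mk⇔ fwd bwd
  where
  sign = symbolAt-∷-odd-consBit a g n₀ n
  fwd : MarkedSucc c true (a ∷ g) (consBit n₀ n) (consBit false x) → flipIf n₀ a ≡ c × Doubled n₀ g n x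
  fwd (e , inj₁ d) = ⊥-elim (consBit-true≢false x 2^∣ g ∣ (trans d (2^∣∷∣ a g)))
  fwd (e , inj₂ (l , q)) with consBit-injective false false x (consBit n₀ n) (suc-injective e)
  ... | _ , refl = trans (sym sign) q , refl , to (<2^∣∷∣⇔ a g true x) l
  bwd : flipIf n₀ a ≡ c × Doubled n₀ g n x → MarkedSucc c true (a ∷ g) (consBit n₀ n) (consBit false x)
  bwd (q , refl , l) = refl , inj₂ (from (<2^∣∷∣⇔ a g true x) l , trans sign q)

MarkedSucc-[]⇒ : ∀ c n₀ n x₀ x → MarkedSucc c true [] (consBit n₀ n) (consBit x₀ x) →
                 n₀ ≡ false × x₀ ≡ false × Zero n x
MarkedSucc-[]⇒ c n₀ n x₀ x (e , inj₂ (s≤s () , _))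
MarkedSucc-[]⇒ c n₀ n true x (e , inj₁ ())
MarkedSucc-[]⇒ c n₀ n false (suc x) (e , inj₁ ())
MarkedSucc-[]⇒ c true n false zero (() , inj₁ refl)
MarkedSucc-[]⇒ c false (suc n) false zero (() , inj₁ refl)
MarkedSucc-[]⇒ c false zero false zero (refl , inj₁ refl) = refl , refl , refl , refl

markedSucc-correct : ∀ c k → StepCorrect (markedSucc c k)
markedSucc-correct c false f n₀ n false x = mk⇔ (λ (e , _) → consBit-true≢false x (consBit n₀ n) e) λ ()
markedSucc-correct c false [] n₀ n true x = mk⇔ (λ { (_ , inj₁ ()) ; (_ , inj₂ (s≤s () , _)) }) λ ()
markedSucc-correct c false (a ∷ g) n₀ n true x rewrite onSign-signToTri a nothing (λ _ → just (markedSucc c n₀)) =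
  MarkedSucc-even-∷⇔ c a g n₀ n x
markedSucc-correct c true f n₀ n true x =
  mk⇔ (λ (e , _) → consBit-true≢false x (consBit n₀ n) (suc-injective e)) λ ()
markedSucc-correct c true [] false n false x =
  mk⇔ (λ m → proj₂ (proj₂ (MarkedSucc-[]⇒ c false n false x m))) λ { (refl , refl) → refl , inj₁ refl }
markedSucc-correct c true [] true n false x =
  mk⇔ (λ m → case proj₁ (MarkedSucc-[]⇒ c true n false x m) of λ ()) λ ()
markedSucc-correct c true (a ∷ g) n₀ n false x
  rewrite onSign-signToTri a (guard (not n₀) (just (zeros {ends})))
                               (λ b → guard (sameSign (flipIf n₀ b) c) (just (doubled {ends} n₀))) =
  ⇔-trans (MarkedSucc-odd-∷⇔ c a g n₀ n x) (⇔-sym (guard-sameSign⇔ (flipIf n₀ a) c (just (doubled n₀))))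

consBit≡consBit-sameSign⇔ : ∀ x₀ x u c m →
  consBit x₀ x ≡ consBit (sameSign u c) m ⇔ (x ≡ m × u ≡ flipIf (not x₀) c)
consBit≡consBit-sameSign⇔ x₀ x u c m = mk⇔ fwd bwd
  where
  fwd : consBit x₀ x ≡ consBit (sameSign u c) m → x ≡ m × u ≡ flipIf (not x₀) c
  fwd e with consBit-injective x₀ (sameSign u c) x m e
  ... | x₀≡ , x≡m = x≡m , to (sameSign≡⇔ u c x₀) (sym x₀≡)
  bwd : x ≡ m × u ≡ flipIf (not x₀) c → consBit x₀ x ≡ consBit (sameSign u c) m
  bwd (refl , u≡) = cong (λ b → consBit b x) (sym (from (sameSign≡⇔ u c x₀) u≡))

alternate-odd : ∀ a p → alternate a (p + suc p) ≡ opposite a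
alternate-odd a p rewrite +-suc p p = alternate-double (opposite a) p

Computed-S-2+⇔ : ∀ a g j x₀ x c → alternate a j ≡ c →
  Computed S (a ∷ g) (2 + j) (consBit x₀ x) ⇔ (x ≡ suc j × x < 2^∣ g ∣ × symbolAt g x ≡ flipIf (not x₀) c)
Computed-S-2+⇔ a g j x₀ x c refl = mk⇔ fwd bwd
  where
  value≡⇔ = consBit≡consBit-sameSign⇔ x₀ x (symbolAt g (suc j)) (alternate a j) (suc j)
  fwd : Computed S (a ∷ g) (2 + j) (consBit x₀ x) →
        x ≡ suc j × x < 2^∣ g ∣ × symbolAt g x ≡ flipIf (not x₀) (alternate a j)
  fwd (l , e) with to value≡⇔ (trans e (S-∷-2+ a g j l))
  ... | refl , q = refl , l , q
  bwd : x ≡ suc j × x < 2^∣ g ∣ × symbolAt g x ≡ flipIf (not x₀) (alternate a j) →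
        Computed S (a ∷ g) (2 + j) (consBit x₀ x)
  bwd (refl , l , q) = l , trans (from value≡⇔ (refl , q)) (sym (S-∷-2+ a g j l))

if-sameSign : ∀ {A : Set} u c b (y z : A) → sameSign u c ≡ b → (if sameSign u c then y else z) ≡ (if b then y else z)
if-sameSign u c b y z eq rewrite eq = refl

Computed-E-odd⇔ : ∀ a g j x c → opposite (alternate a j) ≡ c →
  Computed E (a ∷ g) (suc j) (consBit true x) ⇔ (x ≡ j × MarkedOrEnd c g (suc j))
Computed-E-odd⇔ a g j x c refl = mk⇔ fwd bwd
  where
  fwd : Computed E (a ∷ g) (suc j) (consBit true x) →
        x ≡ j × MarkedOrEnd (opposite (alternate a j)) g (suc j)
  fwd (l , e) with m≤n⇒m<n∨m≡n l
  ... | inj₂ last = proj₂ (consBit-injective true true x j (trans e (E-∷-last a g j last))) , inj₁ last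
  ... | inj₁ lt with sameSign (symbolAt g (suc j)) (alternate a j) in eq | trans e (E-∷-suc a g j lt)
  ...   | true  | e′ = ⊥-elim (consBit-true≢false j x (sym (suc-injective e′)))
  ...   | false | e′ = proj₂ (consBit-injective true true x j e′) , inj₂ (lt , to (sameSign≡⇔ _ _ false) eq)
  bwd : x ≡ j × MarkedOrEnd (opposite (alternate a j)) g (suc j) →
        Computed E (a ∷ g) (suc j) (consBit true x)
  bwd (refl , inj₁ last)     = ≤-reflexive last , sym (E-∷-last a g x last)
  bwd (refl , inj₂ (lt , q)) = <⇒≤ lt , sym (trans (E-∷-suc a g x lt)
    (if-sameSign _ _ false _ _ (from (sameSign≡⇔ (symbolAt g (suc x)) (alternate a x) false) q)))

Computed-E-even⇔ : ∀ a g j x c → alternate a j ≡ c →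
  Computed E (a ∷ g) (suc j) (consBit false x) ⇔ (x ≡ suc j × suc j < 2^∣ g ∣ × symbolAt g (suc j) ≡ c)
Computed-E-even⇔ a g j x c refl = mk⇔ fwd bwd
  where
  fwd : Computed E (a ∷ g) (suc j) (consBit false x) →
        x ≡ suc j × suc j < 2^∣ g ∣ × symbolAt g (suc j) ≡ alternate a j
  fwd (l , e) with m≤n⇒m<n∨m≡n l
  ... | inj₂ last = ⊥-elim (consBit-true≢false j x (sym (trans e (E-∷-last a g j last))))
  ... | inj₁ lt with sameSign (symbolAt g (suc j)) (alternate a j) in eq | trans e (E-∷-suc a g j lt)
  ...   | false | e′ = ⊥-elim (consBit-true≢false j x (sym e′))
  ...   | true  | e′ = proj₂ (consBit-injective false false x (suc j) (trans e′ (sym (double-suc j)))) , lt ,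
                       to (sameSign≡⇔ _ _ true) eq
  bwd : x ≡ suc j × suc j < 2^∣ g ∣ × symbolAt g (suc j) ≡ alternate a j →
        Computed E (a ∷ g) (suc j) (consBit false x)
  bwd (refl , lt , q) = <⇒≤ lt , sym (begin
    E (a ∷ g) (suc j)                                        ≡⟨ E-∷-suc a g j lt ⟩
    (if sameSign (symbolAt g (suc j)) (alternate a j) then suc (consBit true j) else consBit true j)
                                                             ≡⟨ if-sameSign _ _ true _ _ (from (sameSign≡⇔ _ _ true) q) ⟩
    suc (consBit true j)                                     ≡⟨ sym (double-suc j) ⟩
    consBit false (suc j)                                    ∎)
    where open ≡-Reasoning

flipIf-not-opposite : ∀ b a → flipIf (not b) (opposite a) ≡ flipIf b a
flipIf-not-opposite false a = opposite-involutive a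
flipIf-not-opposite true  a = refl

Computed-S-even⇔ : ∀ a g p x₀ x →
  Computed S (a ∷ g) (consBit false (suc p)) (consBit x₀ x) ⇔ MarkedPred (flipIf (not x₀) a) g (suc p) x
Computed-S-even⇔ a g p x₀ x rewrite +-suc p p = ⇔-trans
  (Computed-S-2+⇔ a g (p + p) x₀ x a (alternate-double a p))
  (mk⇔ (λ (e , r) → cong suc e , r) (λ (e , r) → suc-injective e , r))

Computed-S-odd⇔ : ∀ a g p x₀ x →
  Computed S (a ∷ g) (consBit true (suc p)) (consBit x₀ x) ⇔ Marked (flipIf x₀ a) false g (suc p) x
Computed-S-odd⇔ a g p x₀ x = ⇔-trans
  (Computed-S-2+⇔ a g (p + suc p) x₀ x (opposite a) (alternate-odd a p))
  (mk⇔ (λ { (refl , l , q) → refl , s≤s z≤n , l , trans q (flipIf-not-opposite x₀ a) })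
       (λ (e , _ , l , q) → e , l , trans q (sym (flipIf-not-opposite x₀ a))))

Zero-suc-⊎⇔ : ∀ {A : Set} p x → (Zero (suc p) x ⊎ A) ⇔ A
Zero-suc-⊎⇔ p x = mk⇔ (λ { (inj₁ (() , _)) ; (inj₂ h) → h }) inj₂

startStep-starts-correct : ∀ a g n₀ n x₀ x →
  Computed S (a ∷ g) (consBit n₀ n) (consBit x₀ x) ⇔ HoldsAt (startStep starts a n₀ x₀) g n x
startStep-starts-correct a g false zero false x =
  mk⇔ (λ (_ , e) → inj₁ (refl , m+n≡0⇒m≡0 x e)) λ { (inj₁ (_ , refl)) → z≤n , refl ; (inj₂ (() , _)) }
startStep-starts-correct a g false zero true x = mk⇔ (λ { (_ , ()) }) λ { (() , _) }
startStep-starts-correct a g false (suc p) false x =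
  ⇔-trans (Computed-S-even⇔ a g p false x) (⇔-sym (Zero-suc-⊎⇔ p x))
startStep-starts-correct a g false (suc p) true x = Computed-S-even⇔ a g p true x
startStep-starts-correct a g true zero true x = mk⇔
  (λ (_ , e) → inj₁ (refl , m+n≡0⇒m≡0 x (suc-injective (trans e (S-∷-1 a g)))))
  λ { (inj₁ (_ , refl)) → m^n>0 2 (length g) , sym (S-∷-1 a g) ; (inj₂ (refl , () , _)) }
startStep-starts-correct a g true zero false x = mk⇔
  (λ (_ , e) → ⊥-elim (consBit-true≢false 0 x (sym (trans e (S-∷-1 a g)))))
  λ { (refl , () , _) }
startStep-starts-correct a g true (suc p) true x =
  ⇔-trans (Computed-S-odd⇔ a g p true x) (⇔-sym (Zero-suc-⊎⇔ p x))
startStep-starts-correct a g true (suc p) false x = Computed-S-odd⇔ a g p false x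

startStep-ends-correct : ∀ a g n₀ n x₀ x →
  Computed E (a ∷ g) (consBit n₀ n) (consBit x₀ x) ⇔ HoldsAt (startStep ends a n₀ x₀) g n x
startStep-ends-correct a g true n true x =
  ⇔-trans (Computed-E-odd⇔ a g (n + n) x (opposite a) (cong opposite (alternate-double a n)))
          (mk⇔ (λ { (refl , d) → refl , d }) (λ (e , d) → suc-injective e , subst (MarkedOrEnd _ g) e d))
startStep-ends-correct a g true n false x =
  ⇔-trans (Computed-E-even⇔ a g (n + n) x a (alternate-double a n))
          (mk⇔ (λ { (refl , l , q) → refl , s≤s z≤n , l , q }) (λ { (refl , _ , l , q) → refl , l , q }))
startStep-ends-correct a g false zero false x =
  mk⇔ (λ (_ , e) → inj₁ (refl , m+n≡0⇒m≡0 x e)) λ { (inj₁ (_ , refl)) → z≤n , refl ; (inj₂ (refl , () , _)) }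
startStep-ends-correct a g false zero true x = mk⇔ (λ { (_ , ()) }) λ { (() , _) }
startStep-ends-correct a g false (suc p) false x =
  ⇔-trans (Computed-E-even⇔ a g (p + suc p) x (opposite a) (alternate-odd a p)) (⇔-trans
          (mk⇔ (λ { (refl , l , q) → refl , s≤s z≤n , l , q }) (λ { (refl , _ , l , q) → refl , l , q }))
          (⇔-sym (Zero-suc-⊎⇔ p x)))
startStep-ends-correct a g false (suc p) true x =
  ⇔-trans (Computed-E-odd⇔ a g (p + suc p) x a (trans (cong opposite (alternate-odd a p)) (opposite-involutive a)))
          (mk⇔ (λ { (refl , d) → refl , d }) (λ (e , d) → suc-injective e , subst (MarkedOrEnd _ g) e d))

start-correct : ∀ t → StepCorrect (start {t})
start-correct t [] n₀ n x₀ x = mk⇔ (λ ()) (λ ())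
start-correct starts (a ∷ g) n₀ n x₀ x rewrite onSign-signToTri a nothing (λ b → startStep starts b n₀ x₀) =
  startStep-starts-correct a g n₀ n x₀ x
start-correct ends (a ∷ g) n₀ n x₀ x rewrite onSign-signToTri a nothing (λ b → startStep ends b n₀ x₀) =
  startStep-ends-correct a g n₀ n x₀ x

step-correct : ∀ {t} (s : State t) → StepCorrect s
step-correct {t} start             = start-correct t
step-correct zeros                 = zeros-correct
step-correct (doubled k)           = doubled-correct k
step-correct (markedOdd c)         = markedOdd-correct c
step-correct (zerosOrMarkedEven c) = zerosOrMarkedEven-correct c
step-correct doubledPred           = doubledPred-correct
step-correct (markedEven c)        = markedEven-correct c
step-correct (markedPred c)        = markedPred-correct c
step-correct (zerosOrMarkedPred c) = zerosOrMarkedPred-correct c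
step-correct (markedSucc c k)      = markedSucc-correct c k

accepting⇔Invariant-[] : ∀ {t} (s : State t) → accepting s ≡ true ⇔ Invariant s [] 0 0
accepting⇔Invariant-[] start                 = mk⇔ (λ ()) (λ ())
accepting⇔Invariant-[] zeros                 = mk⇔ (λ _ → refl , refl) (λ _ → refl)
accepting⇔Invariant-[] (doubled false)       = mk⇔ (λ _ → refl , s≤s z≤n) (λ _ → refl)
accepting⇔Invariant-[] (doubled true)        = mk⇔ (λ ()) λ { (() , _) }
accepting⇔Invariant-[] (markedOdd c)         = mk⇔ (λ ()) λ { (_ , () , _) }
accepting⇔Invariant-[] (zerosOrMarkedEven c) = mk⇔ (λ _ → inj₁ (refl , refl)) (λ _ → refl)
accepting⇔Invariant-[] doubledPred           = mk⇔ (λ ()) λ { (() , _) }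
accepting⇔Invariant-[] (markedEven c)        = mk⇔ (λ ()) λ { (_ , () , _) }
accepting⇔Invariant-[] (markedPred c)        = mk⇔ (λ ()) λ { (() , _) }
accepting⇔Invariant-[] (zerosOrMarkedPred c) = mk⇔ (λ _ → inj₁ (refl , refl)) (λ _ → refl)
accepting⇔Invariant-[] (markedSucc c false)  = mk⇔ (λ ()) λ { (() , _) }
accepting⇔Invariant-[] (markedSucc c true)   = mk⇔ (λ _ → refl , inj₁ refl) (λ _ → refl)

acceptsFrom : ∀ {t} → Maybe (State t) → List Letter → Bool
acceptsFrom nothing  w       = false
acceptsFrom (just s) []      = accepting s
acceptsFrom (just s) (c ∷ w) = acceptsFrom (step s c) w

input-suc : ∀ L f n x →
  input (suc L) f n x ≡ (headLetter f , (n % 2 ≡ᵇ 1) , (x % 2 ≡ᵇ 1)) ∷ input L (tailSigns f) (n / 2) (x / 2)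
input-suc L []      n x = refl
input-suc L (a ∷ g) n x = refl

/2<2^ : ∀ L n → n < 2 ^ suc L → n / 2 < 2 ^ L
/2<2^ L n lt = m<n*o⇒m/o<n (subst (n <_) (*-comm 2 (2 ^ L)) lt)

acceptsFrom⇔HoldsAt : ∀ {t} (r : Maybe (State t)) L f n x → length f ≤ L → n < 2 ^ L → x < 2 ^ L →
  acceptsFrom r (input L f n x) ≡ true ⇔ HoldsAt r f n x
acceptsFrom⇔HoldsAt nothing  L       f       n       x       _ _ _ = mk⇔ (λ ()) (λ ())
acceptsFrom⇔HoldsAt (just s) zero    []      zero    zero    _ _ _ = accepting⇔Invariant-[] s
acceptsFrom⇔HoldsAt (just s) zero    []      (suc n) x       _ (s≤s ()) _
acceptsFrom⇔HoldsAt (just s) zero    []      zero    (suc x) _ _ (s≤s ())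
acceptsFrom⇔HoldsAt (just s) (suc L) f       n       x       f≤ n< x< rewrite input-suc L f n x =
  ⇔-trans (acceptsFrom⇔HoldsAt next L (tailSigns f) (n / 2) (x / 2) (tail≤ f f≤) (/2<2^ L n n<) (/2<2^ L x x<))
          (⇔-sym (subst₂ (λ n′ x′ → Invariant s f n′ x′ ⇔ HoldsAt next (tailSigns f) (n / 2) (x / 2))
                         (sym (consBit-split n)) (sym (consBit-split x))
                         (step-correct s f n₀ (n / 2) x₀ (x / 2))))
  where
  n₀ = n % 2 ≡ᵇ 1
  x₀ = x % 2 ≡ᵇ 1
  next = step s (headLetter f , n₀ , x₀)
  tail≤ : ∀ f → length f ≤ suc L → length (tailSigns f) ≤ L
  tail≤ []      _       = z≤n
  tail≤ (_ ∷ _) (s≤s l) = l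

-- 15 (resp. 12) states suffice; the remaining indices are unreachable padding.
size : Target → ℕ
size starts = 17
size ends   = 13

stateTable : ∀ t → Vec (State t) (size t)
stateTable starts =
  start ∷ zeros ∷ doubled false ∷ doubled true ∷ doubledPred ∷
  markedOdd s+ ∷ markedOdd s- ∷ zerosOrMarkedEven s+ ∷ zerosOrMarkedEven s- ∷
  markedEven s+ ∷ markedEven s- ∷ markedPred s+ ∷ markedPred s- ∷
  zerosOrMarkedPred s+ ∷ zerosOrMarkedPred s- ∷ start ∷ start ∷ []
stateTable ends =
  start ∷ zeros ∷ doubled false ∷ doubled true ∷
  markedOdd s+ ∷ markedOdd s- ∷ zerosOrMarkedEven s+ ∷ zerosOrMarkedEven s- ∷
  markedSucc s+ false ∷ markedSucc s+ true ∷ markedSucc s- false ∷ markedSucc s- true ∷ start ∷ []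

encode : ∀ {t} → State t → Fin (size t)
encode {starts} start                   = # 0
encode {starts} zeros                   = # 1
encode {starts} (doubled false)         = # 2
encode {starts} (doubled true)          = # 3
encode doubledPred                      = # 4
encode {starts} (markedOdd s+)          = # 5
encode {starts} (markedOdd s-)          = # 6
encode {starts} (zerosOrMarkedEven s+)  = # 7
encode {starts} (zerosOrMarkedEven s-)  = # 8
encode (markedEven s+)                  = # 9
encode (markedEven s-)                  = # 10
encode (markedPred s+)                  = # 11
encode (markedPred s-)                  = # 12
encode (zerosOrMarkedPred s+)           = # 13
encode (zerosOrMarkedPred s-)           = # 14
encode {ends} start                     = # 0
encode {ends} zeros                     = # 1
encode {ends} (doubled false)           = # 2
encode {ends} (doubled true)            = # 3
encode {ends} (markedOdd s+)            = # 4
encode {ends} (markedOdd s-)            = # 5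
encode {ends} (zerosOrMarkedEven s+)    = # 6
encode {ends} (zerosOrMarkedEven s-)    = # 7
encode (markedSucc s+ false)            = # 8
encode (markedSucc s+ true)             = # 9
encode (markedSucc s- false)            = # 10
encode (markedSucc s- true)             = # 11

decode : ∀ {t} → Fin (size t) → State t
decode {t} = lookup (stateTable t)

decode-encode : ∀ {t} (s : State t) → decode (encode s) ≡ s
decode-encode {starts} start                  = refl
decode-encode {starts} zeros                  = refl
decode-encode {starts} (doubled false)        = refl
decode-encode {starts} (doubled true)         = refl
decode-encode doubledPred                     = refl
decode-encode {starts} (markedOdd s+)         = refl
decode-encode {starts} (markedOdd s-)         = refl
decode-encode {starts} (zerosOrMarkedEven s+) = refl
decode-encode {starts} (zerosOrMarkedEven s-) = refl
decode-encode (markedEven s+)                 = refl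
decode-encode (markedEven s-)                 = refl
decode-encode (markedPred s+)                 = refl
decode-encode (markedPred s-)                 = refl
decode-encode (zerosOrMarkedPred s+)          = refl
decode-encode (zerosOrMarkedPred s-)          = refl
decode-encode {ends} start                    = refl
decode-encode {ends} zeros                    = refl
decode-encode {ends} (doubled false)          = refl
decode-encode {ends} (doubled true)           = refl
decode-encode {ends} (markedOdd s+)           = refl
decode-encode {ends} (markedOdd s-)           = refl
decode-encode {ends} (zerosOrMarkedEven s+)   = refl
decode-encode {ends} (zerosOrMarkedEven s-)   = refl
decode-encode (markedSucc s+ false)           = refl
decode-encode (markedSucc s+ true)            = refl
decode-encode (markedSucc s- false)           = refl
decode-encode (markedSucc s- true)            = refl

automaton : ∀ t → DFA (size t)
automaton t = record
  { start  = encode start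
  ; δ      = λ q c → Maybe.map encode (step (decode q) c)
  ; accept = λ q → accepting (decode q)
  }

runFrom-nothing : ∀ {k} (M : DFA k) w → runFrom M nothing w ≡ nothing
runFrom-nothing M []      = refl
runFrom-nothing M (c ∷ w) = runFrom-nothing M w

Accepts-automaton⇔ : ∀ {t} (r : Maybe (State t)) w →
  Σ (Fin (size t)) (λ q → runFrom (automaton t) (Maybe.map encode r) w ≡ just q × accepting (decode q) ≡ true) ⇔
  acceptsFrom r w ≡ true
Accepts-automaton⇔ {t} nothing w =
  mk⇔ (λ (q , e , _) → case trans (sym (runFrom-nothing (automaton t) w)) e of λ ()) (λ ())
Accepts-automaton⇔ (just s) [] = mk⇔ (λ { (q , refl , a) → subst (λ s → accepting s ≡ true) (decode-encode s) a })
                                    (λ a → encode s , refl , subst (λ s → accepting s ≡ true) (sym (decode-encode s)) a)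
Accepts-automaton⇔ (just s) (c ∷ w) rewrite decode-encode s = Accepts-automaton⇔ (step s c) w

automaton-computes : ∀ t → Computes (automaton t) (runFunction t)
automaton-computes t []      ()
automaton-computes t (a ∷ h) _ L n x f≤ n< x< =
  to accepts⇔computed , from accepts⇔computed
  where
  accepts⇔computed = ⇔-trans (Accepts-automaton⇔ (just start) (input L (a ∷ h) n x))
                             (acceptsFrom⇔HoldsAt (just start) L (a ∷ h) n x f≤ n< x<)

theorem2 : Σ (DFA 17) (λ M → Computes M S) × Σ (DFA 13) (λ M → Computes M E)
theorem2 = (automaton starts , automaton-computes starts) , (automaton ends , automaton-computes ends)
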